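{- Let $\varphi(\bar R,X,\bar x)$ be a $\mathrm{GSO}_g$-formula with free second-order variables $\bar R$, $X$ and free first-order variables $\bar x$, which is positive in $X$. One can effectively construct $\mathrm{GSO}_g$-formulae $\psi^0_i(X,\bar x)$ and $\psi^1_i(\bar R,X,\bar x)$, for $i<n$, such that $$\varphi(\bar R,X,\bar x)\equiv\bigvee_{i<n}\bigl[\psi^0_i(X,\bar x)\wedge\psi^1_i(\bar R,X,\bar x)\bigr],$$ where each $\psi^0_i$ is quantifier-free and positive in $X$, and each $\psi^1_i$ is positive in $X$ and $X$ occurs in $\psi^1_i$ only inside subformulae of the form $\forall\bar y\vartheta$ or $\exists\bar y\vartheta$ (first-order quantifications). Furthermore, if $\varphi$ is a $\mathrm{GF}$-formula, then so are all $\psi^0_i,\psi^1_i$.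
   Context: Vocabularies are finite and relational. A subset of a structure is guarded if it is a singleton or the set of components of a tuple in some relation of the structure; a relation is guarded if each of its tuples has its components in a guarded set. Guarded first-order quantification has the form $\exists\bar y(\alpha\wedge\vartheta)$ or $\forall\bar y(\alpha\to\vartheta)$ where $\alpha$ is a relational atom of the vocabulary or an equality containing all free variables of $\vartheta$ and $\bar y$ are among the variables of $\alpha$; second-order variables are never used as guards. $\mathrm{GF}$ is the closure of atomic formulae under boolean connectives and guarded quantification. $\mathrm{GSO}$ extends first-order logic by quantification over guarded relations (of arbitrary arity); $\mathrm{GSO}_g$ is the fragment of $\mathrm{GSO}$ in which all first-order quantifications are guarded. -}

module Defs where

open import Level using (Level; Lift) renaming (suc to lsuc; zero to lzero)
open import Data.Nat using (ℕ)
import Data.Nat as N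
open import Data.Fin using (Fin)
open import Data.Vec using (Vec)
import Data.Vec as V
open import Data.List using (List; []; _∷_; map)
open import Data.List.NonEmpty using (List⁺)
import Data.List.NonEmpty as L⁺
open import Data.List.Membership.Propositional using (_∈_; _∉_)
open import Data.List.Relation.Unary.All using (All)
open import Data.Product using (Σ; _×_; _,_; proj₁; proj₂)
open import Data.Sum using (_⊎_)
open import Data.Empty using (⊥)
open import Data.Unit using (⊤)
open import Relation.Nullary using (¬_; Dec; yes; no)
open import Relation.Binary.PropositionalEquality using (_≡_; _≢_; refl; cong₂)

record Vocabulary : Set where
  field
    size  : ℕ
    arity : Fin size → ℕ
open Vocabulary public

record SVar : Set where
  constructor svar
  field
    name : ℕ
    ar   : ℕ
open SVar public

_≟S_ : (X Y : SVar) → Dec (X ≡ Y)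
svar n a ≟S svar m b with n N.≟ m | a N.≟ b
... | yes refl | yes refl = yes refl
... | no n≢m   | _        = no λ { refl → n≢m refl }
... | yes _    | no a≢b   = no λ { refl → a≢b refl }

-- Syntax of GSO over a vocabulary τ.
-- First-order variables are natural numbers.  First-order quantifiers
-- bind a non-empty block ȳ of variables.  ∀ȳ(α → ϑ) is written
-- all ȳ (or (neg α) ϑ).

data Atom (τ : Vocabulary) : Set where
  rel : (r : Fin (size τ)) → Vec ℕ (arity τ r) → Atom τ
  eq  : ℕ → ℕ → Atom τ

data Formula (τ : Vocabulary) : Set where
  atom : Atom τ → Formula τ
  sv   : (X : SVar) → Vec ℕ (ar X) → Formula τ
  true : Formula τ
  neg  : Formula τ → Formula τ
  and  : Formula τ → Formula τ → Formula τ
  or   : Formula τ → Formula τ → Formula τ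
  ex   : List⁺ ℕ → Formula τ → Formula τ
  all  : List⁺ ℕ → Formula τ → Formula τ
  ex2  : SVar → Formula τ → Formula τ
  all2 : SVar → Formula τ → Formula τ

false : ∀ {τ} → Formula τ
false = neg true

bigOr : ∀ {τ} → List (Formula τ) → Formula τ
bigOr []       = false
bigOr (φ ∷ φs) = or φ (bigOr φs)

varsA : ∀ {τ} → Atom τ → List ℕ
varsA (rel r xs) = V.toList xs
varsA (eq x y)   = x ∷ y ∷ []

FOFree : ∀ {τ} → ℕ → Formula τ → Set
FOFree x (atom a)   = x ∈ varsA a
FOFree x (sv X xs)  = x ∈ V.toList xs
FOFree x true       = ⊥
FOFree x (neg φ)    = FOFree x φ
FOFree x (and φ ψ)  = FOFree x φ ⊎ FOFree x ψ
FOFree x (or φ ψ)   = FOFree x φ ⊎ FOFree x ψ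
FOFree x (ex ys φ)  = x ∉ L⁺.toList ys × FOFree x φ
FOFree x (all ys φ) = x ∉ L⁺.toList ys × FOFree x φ
FOFree x (ex2 Y φ)  = FOFree x φ
FOFree x (all2 Y φ) = FOFree x φ

SOFree : ∀ {τ} → SVar → Formula τ → Set
SOFree Y (atom a)   = ⊥
SOFree Y (sv X xs)  = Y ≡ X
SOFree Y true       = ⊥
SOFree Y (neg φ)    = SOFree Y φ
SOFree Y (and φ ψ)  = SOFree Y φ ⊎ SOFree Y ψ
SOFree Y (or φ ψ)   = SOFree Y φ ⊎ SOFree Y ψ
SOFree Y (ex ys φ)  = SOFree Y φ
SOFree Y (all ys φ) = SOFree Y φ
SOFree Y (ex2 Z φ)  = Y ≢ Z × SOFree Y φ
SOFree Y (all2 Z φ) = Y ≢ Z × SOFree Y φ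

GuardOK : ∀ {τ} → Atom τ → List⁺ ℕ → Formula τ → Set
GuardOK α ys θ = All (λ y → y ∈ varsA α) (L⁺.toList ys)
               × (∀ z → FOFree z θ → z ∈ varsA α)

-- GSO_g: all first-order quantifications are guarded
-- (second-order variables are never guards: α is an Atom).
IsGSOg : ∀ {τ} → Formula τ → Set
IsGSOg (atom a)   = ⊤
IsGSOg (sv X xs)  = ⊤
IsGSOg true       = ⊤
IsGSOg (neg φ)    = IsGSOg φ
IsGSOg (and φ ψ)  = IsGSOg φ × IsGSOg ψ
IsGSOg (or φ ψ)   = IsGSOg φ × IsGSOg ψ
IsGSOg (ex ys (and (atom α) θ))       = GuardOK α ys θ × IsGSOg θ
IsGSOg (ex ys _)  = ⊥
IsGSOg (all ys (or (neg (atom α)) θ)) = GuardOK α ys θ × IsGSOg θ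
IsGSOg (all ys _) = ⊥
IsGSOg (ex2 Y φ)  = IsGSOg φ
IsGSOg (all2 Y φ) = IsGSOg φ

NoSOQuant : ∀ {τ} → Formula τ → Set
NoSOQuant (atom a)   = ⊤
NoSOQuant (sv X xs)  = ⊤
NoSOQuant true       = ⊤
NoSOQuant (neg φ)    = NoSOQuant φ
NoSOQuant (and φ ψ)  = NoSOQuant φ × NoSOQuant ψ
NoSOQuant (or φ ψ)   = NoSOQuant φ × NoSOQuant ψ
NoSOQuant (ex ys φ)  = NoSOQuant φ
NoSOQuant (all ys φ) = NoSOQuant φ
NoSOQuant (ex2 Y φ)  = ⊥
NoSOQuant (all2 Y φ) = ⊥

-- GF: guarded first-order formulae (free second-order variables play
-- the role of additional relation symbols, never used as guards).
IsGF : ∀ {τ} → Formula τ → Set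
IsGF φ = IsGSOg φ × NoSOQuant φ

QuantifierFree : ∀ {τ} → Formula τ → Set
QuantifierFree (atom a)   = ⊤
QuantifierFree (sv X xs)  = ⊤
QuantifierFree true       = ⊤
QuantifierFree (neg φ)    = QuantifierFree φ
QuantifierFree (and φ ψ)  = QuantifierFree φ × QuantifierFree ψ
QuantifierFree (or φ ψ)   = QuantifierFree φ × QuantifierFree ψ
QuantifierFree (ex ys φ)  = ⊥
QuantifierFree (all ys φ) = ⊥
QuantifierFree (ex2 Y φ)  = ⊥
QuantifierFree (all2 Y φ) = ⊥

Pos Neg : ∀ {τ} → SVar → Formula τ → Set
Pos X (atom a)   = ⊤
Pos X (sv Y xs)  = ⊤
Pos X true       = ⊤
Pos X (neg φ)    = Neg X φ
Pos X (and φ ψ)  = Pos X φ × Pos X ψ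
Pos X (or φ ψ)   = Pos X φ × Pos X ψ
Pos X (ex ys φ)  = Pos X φ
Pos X (all ys φ) = Pos X φ
Pos X (ex2 Y φ)  = Y ≡ X ⊎ Pos X φ
Pos X (all2 Y φ) = Y ≡ X ⊎ Pos X φ
Neg X (atom a)   = ⊤
Neg X (sv Y xs)  = Y ≢ X
Neg X true       = ⊤
Neg X (neg φ)    = Pos X φ
Neg X (and φ ψ)  = Neg X φ × Neg X ψ
Neg X (or φ ψ)   = Neg X φ × Neg X ψ
Neg X (ex ys φ)  = Neg X φ
Neg X (all ys φ) = Neg X φ
Neg X (ex2 Y φ)  = Y ≡ X ⊎ Neg X φ
Neg X (all2 Y φ) = Y ≡ X ⊎ Neg X φ

OnlyUnderFOQuant : ∀ {τ} → SVar → Formula τ → Set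
OnlyUnderFOQuant X (atom a)   = ⊤
OnlyUnderFOQuant X (sv Y xs)  = Y ≢ X
OnlyUnderFOQuant X true       = ⊤
OnlyUnderFOQuant X (neg φ)    = OnlyUnderFOQuant X φ
OnlyUnderFOQuant X (and φ ψ)  = OnlyUnderFOQuant X φ × OnlyUnderFOQuant X ψ
OnlyUnderFOQuant X (or φ ψ)   = OnlyUnderFOQuant X φ × OnlyUnderFOQuant X ψ
OnlyUnderFOQuant X (ex ys φ)  = ⊤
OnlyUnderFOQuant X (all ys φ) = ⊤
OnlyUnderFOQuant X (ex2 Y φ)  = Y ≡ X ⊎ OnlyUnderFOQuant X φ
OnlyUnderFOQuant X (all2 Y φ) = Y ≡ X ⊎ OnlyUnderFOQuant X φ

record Structure (τ : Vocabulary) : Set₁ where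
  field
    dom    : Set
    interp : (r : Fin (size τ)) → Vec dom (arity τ r) → Set
open Structure public

_⇔'_ : ∀ {a b} → Set a → Set b → Set _
A ⇔' B = (A → B) × (B → A)

module _ {τ : Vocabulary} (𝔄 : Structure τ) where

  GuardedSet : (dom 𝔄 → Set) → Set
  GuardedSet S =
      Σ (dom 𝔄) (λ a → ∀ b → S b ⇔' (b ≡ a))
    ⊎ Σ (Fin (size τ)) (λ r → Σ (Vec (dom 𝔄) (arity τ r)) (λ t →
        interp 𝔄 r t × (∀ b → S b ⇔' (b ∈ V.toList t))))

  GuardedRel : ∀ {k} → (Vec (dom 𝔄) k → Set) → Set₁
  GuardedRel P = ∀ u → P u →
    Σ (dom 𝔄 → Set) (λ S → GuardedSet S × All S (V.toList u))

  FOAssign : Set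
  FOAssign = ℕ → dom 𝔄

  SOAssign : Set₁
  SOAssign = (X : SVar) → Vec (dom 𝔄) (ar X) → Set

  update : SOAssign → (Y : SVar) → (Vec (dom 𝔄) (ar Y) → Set) → SOAssign
  update ρ Y P Z with Y ≟S Z
  ... | yes refl = P
  ... | no _     = ρ Z

  -- Classical (Tarskian) semantics, rendered constructively via the
  -- Gödel–Gentzen negative translation (∨, ∃ and atoms are ¬¬-ed).
  ⟦_⟧ : Formula τ → FOAssign → SOAssign → Set₁
  ⟦ atom (rel r xs) ⟧ σ ρ = ¬ ¬ Lift (lsuc lzero) (interp 𝔄 r (V.map σ xs))
  ⟦ atom (eq x y) ⟧   σ ρ = ¬ ¬ Lift (lsuc lzero) (σ x ≡ σ y)
  ⟦ sv X xs ⟧ σ ρ = ¬ ¬ Lift (lsuc lzero) (ρ X (V.map σ xs))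
  ⟦ true ⟧    σ ρ = Lift (lsuc lzero) ⊤
  ⟦ neg φ ⟧   σ ρ = ¬ ⟦ φ ⟧ σ ρ
  ⟦ and φ ψ ⟧ σ ρ = ⟦ φ ⟧ σ ρ × ⟦ ψ ⟧ σ ρ
  ⟦ or φ ψ ⟧  σ ρ = ¬ ¬ (⟦ φ ⟧ σ ρ ⊎ ⟦ ψ ⟧ σ ρ)
  ⟦ ex ys φ ⟧ σ ρ = ¬ ¬ Σ FOAssign (λ σ′ →
      (∀ z → z ∉ L⁺.toList ys → σ′ z ≡ σ z) × ⟦ φ ⟧ σ′ ρ)
  ⟦ all ys φ ⟧ σ ρ = ∀ σ′ → (∀ z → z ∉ L⁺.toList ys → σ′ z ≡ σ z) → ⟦ φ ⟧ σ′ ρ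
  ⟦ ex2 Y φ ⟧ σ ρ = ¬ ¬ Σ (Vec (dom 𝔄) (ar Y) → Set) (λ P →
      GuardedRel P × ⟦ φ ⟧ σ (update ρ Y P))
  ⟦ all2 Y φ ⟧ σ ρ = ∀ (P : Vec (dom 𝔄) (ar Y) → Set) →
      GuardedRel P → ⟦ φ ⟧ σ (update ρ Y P)

_≡ₗ_ : ∀ {τ} → Formula τ → Formula τ → Set₁
_≡ₗ_ {τ} φ ψ = ∀ (𝔄 : Structure τ) (σ : FOAssign 𝔄) (ρ : SOAssign 𝔄) →
  ⟦ 𝔄 ⟧ φ σ ρ ⇔' ⟦ 𝔄 ⟧ ψ σ ρ

FOVarsIn : ∀ {τ} → Formula τ → List ℕ → Set
FOVarsIn φ xs = ∀ z → FOFree z φ → z ∈ xs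

SOVarsIn : ∀ {τ} → Formula τ → List SVar → Set
SOVarsIn φ Ys = ∀ Y → SOFree Y φ → Y ∈ Ys

module Submission where

-- Shannon expansion along the atoms X v̄ of φ that lie outside every
-- first-order quantifier.  Since φ is positive in X, replacing such an atom by
-- ⊤ (resp. ⊥) weakens (resp. strengthens) φ; as φ is φ[X v̄ ≔ X v̄], this gives
--   φ ≡ (X v̄ ∧ φ[X v̄ ≔ ⊤]) ∨ φ[X v̄ ≔ ⊥].
-- Expanding along all such atoms X v̄₁, …, X v̄ₖ yields the disjuncts
--   (⋀_{i ∈ S} X v̄ᵢ) ∧ φ[X v̄ᵢ ≔ ⊤ for i ∈ S, X v̄ᵢ ≔ ⊥ for i ∉ S],
-- whose second conjunct contains X only under first-order quantifiers.
-- Replacing atoms by ⊤ or ⊥ preserves guardedness, positivity, the free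
-- variables and membership in GF.

open import Level using (Lift; lift) renaming (suc to lsuc; zero to lzero)
open import Defs
open import Data.Nat using (ℕ)
import Data.Nat as ℕ
open import Data.Vec using (Vec; toList)
import Data.Vec as Vec
import Data.Vec.Properties as Vec
open import Data.List using (List; []; _∷_; map; _++_)
open import Data.List.Relation.Unary.All using (All; []; _∷_)
import Data.List.Relation.Unary.All as All
import Data.List.Relation.Unary.All.Properties as All
open import Data.List.Relation.Unary.Any using (here)
import Data.List.Relation.Unary.Any as Any
open import Data.List.Membership.Propositional using (_∈_)
open import Data.List.Membership.Propositional.Properties using (∈-++⁺ˡ; ∈-++⁺ʳ; ∈-++⁻)
open import Data.List.Relation.Binary.Subset.Propositional using (_⊆_)
open import Data.Product using (Σ; _×_; _,_; proj₁; proj₂; map₁; assocʳ′; assocˡ′; uncurry)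
import Data.Product as Product
open import Data.Sum using (_⊎_; inj₁; inj₂; [_,_]′)
import Data.Sum as Sum
open import Data.Unit using (tt)
open import Function using (id; _∘_; flip)
open import Relation.Nullary using (¬_; yes; no)
open import Relation.Nullary.Negation using (Stable; contradiction; negated-stable; ¬¬-map)
open import Relation.Binary using (IsEquivalence; Setoid; DecidableEquality)
import Relation.Binary.Reasoning.Setoid as SetoidReasoning
open import Relation.Binary.PropositionalEquality using (_≡_; _≢_; refl; sym; trans; cong; cong₂; subst)

module _ {τ : Vocabulary} (𝔄 : Structure τ) where

  ⟦⟧-stable : ∀ φ σ ρ → Stable (⟦ 𝔄 ⟧ φ σ ρ)
  ⟦⟧-stable (atom (rel r xs)) σ ρ h = negated-stable h
  ⟦⟧-stable (atom (eq x y))   σ ρ h = negated-stable h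
  ⟦⟧-stable (sv X xs)  σ ρ h = negated-stable h
  ⟦⟧-stable true       σ ρ h = lift tt
  ⟦⟧-stable (neg φ)    σ ρ h = negated-stable h
  ⟦⟧-stable (and φ ψ)  σ ρ h = ⟦⟧-stable φ σ ρ (¬¬-map proj₁ h) , ⟦⟧-stable ψ σ ρ (¬¬-map proj₂ h)
  ⟦⟧-stable (or φ ψ)   σ ρ h = negated-stable h
  ⟦⟧-stable (ex ys φ)  σ ρ h = negated-stable h
  ⟦⟧-stable (all ys φ) σ ρ h σ′ agree = ⟦⟧-stable φ σ′ ρ (¬¬-map (λ f → f σ′ agree) h)
  ⟦⟧-stable (ex2 Y φ)  σ ρ h = negated-stable h
  ⟦⟧-stable (all2 Y φ) σ ρ h P g = ⟦⟧-stable φ σ (update 𝔄 ρ Y P) (¬¬-map (λ f → f P g) h)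

  update-≢ : ∀ ρ {Y} P {Z} → Y ≢ Z → update 𝔄 ρ Y P Z ≡ ρ Z
  update-≢ ρ {Y} P {Z} Y≢Z with Y ≟S Z
  ... | yes Y≡Z = contradiction Y≡Z Y≢Z
  ... | no _    = refl

  ⟦sv⟧-cong : ∀ σ (ρ ρ′ : SOAssign 𝔄) X xs → ρ X ≡ ρ′ X → ⟦ 𝔄 ⟧ (sv X xs) σ ρ → ⟦ 𝔄 ⟧ (sv X xs) σ ρ′
  ⟦sv⟧-cong σ ρ ρ′ X xs ρX≡ρ′X = subst (λ P → ¬ ¬ Lift (lsuc lzero) (P (Vec.map σ xs))) ρX≡ρ′X

-- _≡ₗ_ computes to a statement about ⟦_⟧, from which its two sides cannot
-- be inferred; the record makes them inferable.
record _≈ₗ_ {τ : Vocabulary} (φ ψ : Formula τ) : Set₁ where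
  constructor mk≈ₗ
  field equivalent : φ ≡ₗ ψ
open _≈ₗ_ public

infix 4 _≈ₗ_

module _ {τ : Vocabulary} where

  ≈ₗ-isEquivalence : IsEquivalence (_≈ₗ_ {τ})
  ≈ₗ-isEquivalence = record
    { refl  = mk≈ₗ λ 𝔄 σ ρ → id , id
    ; sym   = λ (mk≈ₗ e) → mk≈ₗ λ 𝔄 σ ρ → proj₂ (e 𝔄 σ ρ) , proj₁ (e 𝔄 σ ρ)
    ; trans = λ (mk≈ₗ e) (mk≈ₗ f) → mk≈ₗ λ 𝔄 σ ρ →
        proj₁ (f 𝔄 σ ρ) ∘ proj₁ (e 𝔄 σ ρ) , proj₂ (e 𝔄 σ ρ) ∘ proj₂ (f 𝔄 σ ρ)
    }

  ≈ₗ-setoid : Setoid lzero (lsuc lzero)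
  ≈ₗ-setoid = record { isEquivalence = ≈ₗ-isEquivalence }

  open IsEquivalence ≈ₗ-isEquivalence public using () renaming (refl to ≈ₗ-refl)

  and-cong : ∀ {φ φ′ ψ ψ′ : Formula τ} → φ ≈ₗ φ′ → ψ ≈ₗ ψ′ → and φ ψ ≈ₗ and φ′ ψ′
  and-cong (mk≈ₗ e) (mk≈ₗ f) = mk≈ₗ λ 𝔄 σ ρ →
      Product.map (proj₁ (e 𝔄 σ ρ)) (proj₁ (f 𝔄 σ ρ))
    , Product.map (proj₂ (e 𝔄 σ ρ)) (proj₂ (f 𝔄 σ ρ))

  or-cong : ∀ {φ φ′ ψ ψ′ : Formula τ} → φ ≈ₗ φ′ → ψ ≈ₗ ψ′ → or φ ψ ≈ₗ or φ′ ψ′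
  or-cong (mk≈ₗ e) (mk≈ₗ f) = mk≈ₗ λ 𝔄 σ ρ →
      ¬¬-map (Sum.map (proj₁ (e 𝔄 σ ρ)) (proj₁ (f 𝔄 σ ρ)))
    , ¬¬-map (Sum.map (proj₂ (e 𝔄 σ ρ)) (proj₂ (f 𝔄 σ ρ)))

  and-identityˡ : (φ : Formula τ) → and true φ ≈ₗ φ
  and-identityˡ φ = mk≈ₗ λ 𝔄 σ ρ → proj₂ , (lift tt ,_)

  and-zeroʳ : (φ : Formula τ) → and φ false ≈ₗ false
  and-zeroʳ φ = mk≈ₗ λ 𝔄 σ ρ → proj₂ , contradiction (lift tt)

  or-identityˡ : (φ : Formula τ) → or false φ ≈ₗ φ
  or-identityˡ φ = mk≈ₗ λ 𝔄 σ ρ →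
      (λ h → ⟦⟧-stable 𝔄 φ σ ρ (¬¬-map [ contradiction (lift tt) , id ]′ h))
    , contradiction ∘ inj₂

  or-identityʳ : (φ : Formula τ) → or φ false ≈ₗ φ
  or-identityʳ φ = mk≈ₗ λ 𝔄 σ ρ →
      (λ h → ⟦⟧-stable 𝔄 φ σ ρ (¬¬-map [ id , contradiction (lift tt) ]′ h))
    , contradiction ∘ inj₁

  and-assoc : (φ ψ χ : Formula τ) → and (and φ ψ) χ ≈ₗ and φ (and ψ χ)
  and-assoc φ ψ χ = mk≈ₗ λ 𝔄 σ ρ → assocʳ′ , assocˡ′

  or-assoc : (φ ψ χ : Formula τ) → or (or φ ψ) χ ≈ₗ or φ (or ψ χ)
  or-assoc φ ψ χ = mk≈ₗ λ 𝔄 σ ρ →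
      (λ h k → h [ (λ φψ → φψ [ k ∘ inj₁ , k ∘ inj₂ ∘ contradiction ∘ inj₁ ]′)
                 , k ∘ inj₂ ∘ contradiction ∘ inj₂ ]′)
    , (λ h k → h [ k ∘ inj₁ ∘ contradiction ∘ inj₁
                 , (λ ψχ → ψχ [ k ∘ inj₁ ∘ contradiction ∘ inj₂ , k ∘ inj₂ ]′) ]′)

  and-distribˡ-or : (φ ψ χ : Formula τ) → and φ (or ψ χ) ≈ₗ or (and φ ψ) (and φ χ)
  and-distribˡ-or φ ψ χ = mk≈ₗ λ 𝔄 σ ρ →
      (λ (a , ψχ) → ¬¬-map (Sum.map (a ,_) (a ,_)) ψχ)
    , λ h → ⟦⟧-stable 𝔄 φ σ ρ (¬¬-map [ proj₁ , proj₁ ]′ h) , ¬¬-map (Sum.map proj₂ proj₂) h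

  ⋁ : List (Formula τ × Formula τ) → Formula τ
  ⋁ ψs = bigOr (map (uncurry and) ψs)

  ⋁-++-map-and : ∀ α ψs χs → ⋁ (map (map₁ (and α)) ψs ++ χs) ≈ₗ or (and α (⋁ ψs)) (⋁ χs)
  ⋁-++-map-and α [] χs = begin
    ⋁ χs                     ≈⟨ or-identityˡ (⋁ χs) ⟨
    or false (⋁ χs)          ≈⟨ or-cong (and-zeroʳ α) ≈ₗ-refl ⟨
    or (and α false) (⋁ χs)  ∎
    where open SetoidReasoning ≈ₗ-setoid
  ⋁-++-map-and α ((β , γ) ∷ ψs) χs = begin
    or (and (and α β) γ) (⋁ (map (map₁ (and α)) ψs ++ χs))
      ≈⟨ or-cong (and-assoc α β γ) (⋁-++-map-and α ψs χs) ⟩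
    or (and α (and β γ)) (or (and α (⋁ ψs)) (⋁ χs))
      ≈⟨ or-assoc _ _ _ ⟨
    or (or (and α (and β γ)) (and α (⋁ ψs))) (⋁ χs)
      ≈⟨ or-cong (and-distribˡ-or α (and β γ) (⋁ ψs)) ≈ₗ-refl ⟨
    or (and α (or (and β γ) (⋁ ψs))) (⋁ χs)
      ∎
    where open SetoidReasoning ≈ₗ-setoid

≟S-refl : ∀ X → (X ≟S X) ≡ yes refl
≟S-refl X with X ≟S X
... | yes refl = refl
... | no X≢X   = contradiction refl X≢X

module Expansion {τ : Vocabulary} (X : SVar) where

  _≟ᵥ_ : DecidableEquality (Vec ℕ (ar X))
  _≟ᵥ_ = Vec.≡-dec ℕ._≟_

  topLevelArgs : Formula τ → List (Vec ℕ (ar X))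
  topLevelArgs (atom a) = []
  topLevelArgs (sv Y xs) with Y ≟S X
  ... | yes refl = xs ∷ []
  ... | no _     = []
  topLevelArgs true       = []
  topLevelArgs (neg φ)    = topLevelArgs φ
  topLevelArgs (and φ ψ)  = topLevelArgs φ ++ topLevelArgs ψ
  topLevelArgs (or φ ψ)   = topLevelArgs φ ++ topLevelArgs ψ
  topLevelArgs (ex ys φ)  = []
  topLevelArgs (all ys φ) = []
  topLevelArgs (ex2 Y φ) with Y ≟S X
  ... | yes _ = []
  ... | no _  = topLevelArgs φ
  topLevelArgs (all2 Y φ) with Y ≟S X
  ... | yes _ = []
  ... | no _  = topLevelArgs φ

  infixl 8 _[_≔_]
  _[_≔_] : Formula τ → Vec ℕ (ar X) → Formula τ → Formula τ
  atom a [ v ≔ b ] = atom a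
  sv Y xs [ v ≔ b ] with Y ≟S X
  ... | no _ = sv Y xs
  ... | yes refl with xs ≟ᵥ v
  ...   | yes _ = b
  ...   | no _  = sv X xs
  true [ v ≔ b ]       = true
  neg φ [ v ≔ b ]      = neg (φ [ v ≔ b ])
  and φ ψ [ v ≔ b ]    = and (φ [ v ≔ b ]) (ψ [ v ≔ b ])
  or φ ψ [ v ≔ b ]     = or (φ [ v ≔ b ]) (ψ [ v ≔ b ])
  ex ys φ [ v ≔ b ]    = ex ys φ
  all ys φ [ v ≔ b ]   = all ys φ
  ex2 Y φ [ v ≔ b ] with Y ≟S X
  ... | yes _ = ex2 Y φ
  ... | no _  = ex2 Y (φ [ v ≔ b ])
  all2 Y φ [ v ≔ b ] with Y ≟S X
  ... | yes _ = all2 Y φ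
  ... | no _  = all2 Y (φ [ v ≔ b ])

  module _ (v : Vec ℕ (ar X)) (b : Formula τ) where

    [≔]-isGSOg : ∀ φ → IsGSOg b → IsGSOg φ → IsGSOg (φ [ v ≔ b ])
    [≔]-isGSOg (atom a) gb g = g
    [≔]-isGSOg (sv Y xs) gb g with Y ≟S X
    ... | no _ = tt
    ... | yes refl with xs ≟ᵥ v
    ...   | yes _ = gb
    ...   | no _  = tt
    [≔]-isGSOg true       gb g = g
    [≔]-isGSOg (neg φ)    gb g = [≔]-isGSOg φ gb g
    [≔]-isGSOg (and φ ψ)  gb (g , h) = [≔]-isGSOg φ gb g , [≔]-isGSOg ψ gb h
    [≔]-isGSOg (or φ ψ)   gb (g , h) = [≔]-isGSOg φ gb g , [≔]-isGSOg ψ gb h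
    [≔]-isGSOg (ex ys φ)  gb g = g
    [≔]-isGSOg (all ys φ) gb g = g
    [≔]-isGSOg (ex2 Y φ) gb g with Y ≟S X
    ... | yes _ = g
    ... | no _  = [≔]-isGSOg φ gb g
    [≔]-isGSOg (all2 Y φ) gb g with Y ≟S X
    ... | yes _ = g
    ... | no _  = [≔]-isGSOg φ gb g

    [≔]-noSOQuant : ∀ φ → NoSOQuant b → NoSOQuant φ → NoSOQuant (φ [ v ≔ b ])
    [≔]-noSOQuant (atom a) nb n = n
    [≔]-noSOQuant (sv Y xs) nb n with Y ≟S X
    ... | no _ = tt
    ... | yes refl with xs ≟ᵥ v
    ...   | yes _ = nb
    ...   | no _  = tt
    [≔]-noSOQuant true       nb n = n
    [≔]-noSOQuant (neg φ)    nb n = [≔]-noSOQuant φ nb n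
    [≔]-noSOQuant (and φ ψ)  nb (n , m) = [≔]-noSOQuant φ nb n , [≔]-noSOQuant ψ nb m
    [≔]-noSOQuant (or φ ψ)   nb (n , m) = [≔]-noSOQuant φ nb n , [≔]-noSOQuant ψ nb m
    [≔]-noSOQuant (ex ys φ)  nb n = n
    [≔]-noSOQuant (all ys φ) nb n = n

    [≔]-pos : ∀ φ → Pos X b → Pos X φ → Pos X (φ [ v ≔ b ])
    [≔]-neg : ∀ φ → Pos X b → Neg X φ → Neg X (φ [ v ≔ b ])
    [≔]-pos (atom a) pb p = p
    [≔]-pos (sv Y xs) pb p with Y ≟S X
    ... | no _ = p
    ... | yes refl with xs ≟ᵥ v
    ...   | yes _ = pb
    ...   | no _  = p
    [≔]-pos true       pb p = p
    [≔]-pos (neg φ)    pb p = [≔]-neg φ pb p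
    [≔]-pos (and φ ψ)  pb (p , q) = [≔]-pos φ pb p , [≔]-pos ψ pb q
    [≔]-pos (or φ ψ)   pb (p , q) = [≔]-pos φ pb p , [≔]-pos ψ pb q
    [≔]-pos (ex ys φ)  pb p = p
    [≔]-pos (all ys φ) pb p = p
    [≔]-pos (ex2 Y φ) pb p with Y ≟S X
    ... | yes _ = p
    ... | no _  = Sum.map₂ ([≔]-pos φ pb) p
    [≔]-pos (all2 Y φ) pb p with Y ≟S X
    ... | yes _ = p
    ... | no _  = Sum.map₂ ([≔]-pos φ pb) p
    [≔]-neg (atom a) pb n = n
    [≔]-neg (sv Y xs) pb n with Y ≟S X
    ... | no _     = n
    ... | yes refl = contradiction refl n
    [≔]-neg true       pb n = n
    [≔]-neg (neg φ)    pb n = [≔]-pos φ pb n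
    [≔]-neg (and φ ψ)  pb (n , m) = [≔]-neg φ pb n , [≔]-neg ψ pb m
    [≔]-neg (or φ ψ)   pb (n , m) = [≔]-neg φ pb n , [≔]-neg ψ pb m
    [≔]-neg (ex ys φ)  pb n = n
    [≔]-neg (all ys φ) pb n = n
    [≔]-neg (ex2 Y φ) pb n with Y ≟S X
    ... | yes _ = n
    ... | no _  = Sum.map₂ ([≔]-neg φ pb) n
    [≔]-neg (all2 Y φ) pb n with Y ≟S X
    ... | yes _ = n
    ... | no _  = Sum.map₂ ([≔]-neg φ pb) n

    [≔]-SOFree : ∀ φ {Z} → SOFree Z (φ [ v ≔ b ]) → SOFree Z φ ⊎ SOFree Z b
    [≔]-SOFree (atom a) ()
    [≔]-SOFree (sv Y xs) h with Y ≟S X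
    ... | no _ = inj₁ h
    ... | yes refl with xs ≟ᵥ v
    ...   | yes _ = inj₂ h
    ...   | no _  = inj₁ h
    [≔]-SOFree true ()
    [≔]-SOFree (neg φ)    h = [≔]-SOFree φ h
    [≔]-SOFree (and φ ψ)  (inj₁ h) = Sum.map₁ inj₁ ([≔]-SOFree φ h)
    [≔]-SOFree (and φ ψ)  (inj₂ h) = Sum.map₁ inj₂ ([≔]-SOFree ψ h)
    [≔]-SOFree (or φ ψ)   (inj₁ h) = Sum.map₁ inj₁ ([≔]-SOFree φ h)
    [≔]-SOFree (or φ ψ)   (inj₂ h) = Sum.map₁ inj₂ ([≔]-SOFree ψ h)
    [≔]-SOFree (ex ys φ)  h = inj₁ h
    [≔]-SOFree (all ys φ) h = inj₁ h
    [≔]-SOFree (ex2 Y φ) h with Y ≟S X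
    ... | yes _ = inj₁ h
    ... | no _  = Sum.map₁ (proj₁ h ,_) ([≔]-SOFree φ (proj₂ h))
    [≔]-SOFree (all2 Y φ) h with Y ≟S X
    ... | yes _ = inj₁ h
    ... | no _  = Sum.map₁ (proj₁ h ,_) ([≔]-SOFree φ (proj₂ h))

    [≔]-FOFree : ∀ φ {z} → FOFree z (φ [ v ≔ b ]) → FOFree z φ ⊎ FOFree z b
    [≔]-FOFree (atom a) h = inj₁ h
    [≔]-FOFree (sv Y xs) h with Y ≟S X
    ... | no _ = inj₁ h
    ... | yes refl with xs ≟ᵥ v
    ...   | yes _ = inj₂ h
    ...   | no _  = inj₁ h
    [≔]-FOFree true ()
    [≔]-FOFree (neg φ)    h = [≔]-FOFree φ h
    [≔]-FOFree (and φ ψ)  (inj₁ h) = Sum.map₁ inj₁ ([≔]-FOFree φ h)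
    [≔]-FOFree (and φ ψ)  (inj₂ h) = Sum.map₁ inj₂ ([≔]-FOFree ψ h)
    [≔]-FOFree (or φ ψ)   (inj₁ h) = Sum.map₁ inj₁ ([≔]-FOFree φ h)
    [≔]-FOFree (or φ ψ)   (inj₂ h) = Sum.map₁ inj₂ ([≔]-FOFree ψ h)
    [≔]-FOFree (ex ys φ)  h = inj₁ h
    [≔]-FOFree (all ys φ) h = inj₁ h
    [≔]-FOFree (ex2 Y φ) h with Y ≟S X
    ... | yes _ = inj₁ h
    ... | no _  = [≔]-FOFree φ h
    [≔]-FOFree (all2 Y φ) h with Y ≟S X
    ... | yes _ = inj₁ h
    ... | no _  = [≔]-FOFree φ h

    -- topLevelArgs of a rebuilt atom or binder decides Y ≟S X anew, hence the
    -- repeated case splits.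
    [≔]-topLevelArgs : ∀ φ {w} → w ∈ topLevelArgs (φ [ v ≔ b ]) →
                       (w ∈ topLevelArgs φ × w ≢ v) ⊎ w ∈ topLevelArgs b
    [≔]-topLevelArgs (sv Y xs) h with Y ≟S X
    ... | yes refl with xs ≟ᵥ v
    ...   | yes _ = inj₂ h
    ...   | no xs≢v rewrite ≟S-refl X with h
    ...     | here refl = inj₁ (here refl , xs≢v)
    [≔]-topLevelArgs (sv Y xs) h | no Y≢X with Y ≟S X
    ...   | yes Y≡X = contradiction Y≡X Y≢X
    [≔]-topLevelArgs (neg φ) h = [≔]-topLevelArgs φ h
    [≔]-topLevelArgs (and φ ψ) h =
      [ Sum.map₁ (map₁ ∈-++⁺ˡ) ∘ [≔]-topLevelArgs φ
      , Sum.map₁ (map₁ (∈-++⁺ʳ _)) ∘ [≔]-topLevelArgs ψ ]′ (∈-++⁻ (topLevelArgs (φ [ v ≔ b ])) h)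
    [≔]-topLevelArgs (or φ ψ) h =
      [ Sum.map₁ (map₁ ∈-++⁺ˡ) ∘ [≔]-topLevelArgs φ
      , Sum.map₁ (map₁ (∈-++⁺ʳ _)) ∘ [≔]-topLevelArgs ψ ]′ (∈-++⁻ (topLevelArgs (φ [ v ≔ b ])) h)
    [≔]-topLevelArgs (ex2 Y φ) h with Y ≟S X
    ... | yes refl rewrite ≟S-refl X with h
    ...   | ()
    [≔]-topLevelArgs (ex2 Y φ) h | no Y≢X with Y ≟S X
    ...   | yes Y≡X = contradiction Y≡X Y≢X
    ...   | no _    = [≔]-topLevelArgs φ h
    [≔]-topLevelArgs (all2 Y φ) h with Y ≟S X
    ... | yes refl rewrite ≟S-refl X with h
    ...   | ()
    [≔]-topLevelArgs (all2 Y φ) h | no Y≢X with Y ≟S X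
    ...   | yes Y≡X = contradiction Y≡X Y≢X
    ...   | no _    = [≔]-topLevelArgs φ h

  [≔]-self : ∀ v φ → φ [ v ≔ sv X v ] ≡ φ
  [≔]-self v (atom a) = refl
  [≔]-self v (sv Y xs) with Y ≟S X
  ... | no _ = refl
  ... | yes refl with xs ≟ᵥ v
  ...   | yes xs≡v = cong (sv X) (sym xs≡v)
  ...   | no _     = refl
  [≔]-self v true       = refl
  [≔]-self v (neg φ)    = cong neg ([≔]-self v φ)
  [≔]-self v (and φ ψ)  = cong₂ and ([≔]-self v φ) ([≔]-self v ψ)
  [≔]-self v (or φ ψ)   = cong₂ or ([≔]-self v φ) ([≔]-self v ψ)
  [≔]-self v (ex ys φ)  = refl
  [≔]-self v (all ys φ) = refl
  [≔]-self v (ex2 Y φ) with Y ≟S X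
  ... | yes _ = refl
  ... | no _  = cong (ex2 Y) ([≔]-self v φ)
  [≔]-self v (all2 Y φ) with Y ≟S X
  ... | yes _ = refl
  ... | no _  = cong (all2 Y) ([≔]-self v φ)

  topLevelArgs-FOFree : ∀ φ {w z} → w ∈ topLevelArgs φ → z ∈ toList w → FOFree z φ
  topLevelArgs-FOFree (sv Y xs) w∈ z∈ with Y ≟S X
  topLevelArgs-FOFree (sv Y xs) (here refl) z∈ | yes refl = z∈
  topLevelArgs-FOFree (neg φ) w∈ z∈ = topLevelArgs-FOFree φ w∈ z∈
  topLevelArgs-FOFree (and φ ψ) w∈ z∈ =
    Sum.map (λ w∈φ → topLevelArgs-FOFree φ w∈φ z∈) (λ w∈ψ → topLevelArgs-FOFree ψ w∈ψ z∈)
            (∈-++⁻ (topLevelArgs φ) w∈)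
  topLevelArgs-FOFree (or φ ψ) w∈ z∈ =
    Sum.map (λ w∈φ → topLevelArgs-FOFree φ w∈φ z∈) (λ w∈ψ → topLevelArgs-FOFree ψ w∈ψ z∈)
            (∈-++⁻ (topLevelArgs φ) w∈)
  topLevelArgs-FOFree (ex2 Y φ) w∈ z∈ with Y ≟S X
  ... | no _ = topLevelArgs-FOFree φ w∈ z∈
  topLevelArgs-FOFree (all2 Y φ) w∈ z∈ with Y ≟S X
  ... | no _ = topLevelArgs-FOFree φ w∈ z∈

  topLevelArgs⊆[]⇒onlyUnderFOQuant : ∀ φ → topLevelArgs φ ⊆ [] → OnlyUnderFOQuant X φ
  topLevelArgs⊆[]⇒onlyUnderFOQuant (atom a) _ = tt
  topLevelArgs⊆[]⇒onlyUnderFOQuant (sv Y xs) ⊆[] with Y ≟S X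
  ... | yes refl = contradiction (⊆[] (here refl)) λ ()
  ... | no Y≢X   = Y≢X
  topLevelArgs⊆[]⇒onlyUnderFOQuant true _ = tt
  topLevelArgs⊆[]⇒onlyUnderFOQuant (neg φ) ⊆[] = topLevelArgs⊆[]⇒onlyUnderFOQuant φ ⊆[]
  topLevelArgs⊆[]⇒onlyUnderFOQuant (and φ ψ) ⊆[] =
      topLevelArgs⊆[]⇒onlyUnderFOQuant φ (⊆[] ∘ ∈-++⁺ˡ)
    , topLevelArgs⊆[]⇒onlyUnderFOQuant ψ (⊆[] ∘ ∈-++⁺ʳ (topLevelArgs φ))
  topLevelArgs⊆[]⇒onlyUnderFOQuant (or φ ψ) ⊆[] =
      topLevelArgs⊆[]⇒onlyUnderFOQuant φ (⊆[] ∘ ∈-++⁺ˡ)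
    , topLevelArgs⊆[]⇒onlyUnderFOQuant ψ (⊆[] ∘ ∈-++⁺ʳ (topLevelArgs φ))
  topLevelArgs⊆[]⇒onlyUnderFOQuant (ex ys φ) _ = tt
  topLevelArgs⊆[]⇒onlyUnderFOQuant (all ys φ) _ = tt
  topLevelArgs⊆[]⇒onlyUnderFOQuant (ex2 Y φ) ⊆[] with Y ≟S X
  ... | yes Y≡X = inj₁ Y≡X
  ... | no _    = inj₂ (topLevelArgs⊆[]⇒onlyUnderFOQuant φ ⊆[])
  topLevelArgs⊆[]⇒onlyUnderFOQuant (all2 Y φ) ⊆[] with Y ≟S X
  ... | yes Y≡X = inj₁ Y≡X
  ... | no _    = inj₂ (topLevelArgs⊆[]⇒onlyUnderFOQuant φ ⊆[])

  module _ {𝔄 : Structure τ} {σ : FOAssign 𝔄} (v : Vec ℕ (ar X)) {b c : Formula τ}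
           (P : Vec (dom 𝔄) (ar X) → Set)
           (b⇒c : ∀ ρ → ρ X ≡ P → ⟦ 𝔄 ⟧ b σ ρ → ⟦ 𝔄 ⟧ c σ ρ) where

    private
      update-keeps : ∀ {ρ Y} → ρ X ≡ P → ∀ Q → Y ≢ X → update 𝔄 ρ Y Q X ≡ P
      update-keeps ρX≡P Q Y≢X = trans (update-≢ 𝔄 _ Q Y≢X) ρX≡P

      unbound : ∀ {Y} {A : Set} → Y ≢ X → Y ≡ X ⊎ A → A
      unbound Y≢X = Sum.fromInj₂ (flip contradiction Y≢X)

    [≔]-monotone : ∀ φ ρ → ρ X ≡ P → Pos X φ → ⟦ 𝔄 ⟧ (φ [ v ≔ b ]) σ ρ → ⟦ 𝔄 ⟧ (φ [ v ≔ c ]) σ ρ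
    [≔]-antitone : ∀ φ ρ → ρ X ≡ P → Neg X φ → ⟦ 𝔄 ⟧ (φ [ v ≔ c ]) σ ρ → ⟦ 𝔄 ⟧ (φ [ v ≔ b ]) σ ρ
    [≔]-monotone (atom a) ρ ρX≡P p h = h
    [≔]-monotone (sv Y xs) ρ ρX≡P p h with Y ≟S X
    ... | no _ = h
    ... | yes refl with xs ≟ᵥ v
    ...   | yes _ = b⇒c ρ ρX≡P h
    ...   | no _  = h
    [≔]-monotone true ρ ρX≡P p h = h
    [≔]-monotone (neg φ) ρ ρX≡P p h = h ∘ [≔]-antitone φ ρ ρX≡P p
    [≔]-monotone (and φ ψ) ρ ρX≡P (p , q) =
      Product.map ([≔]-monotone φ ρ ρX≡P p) ([≔]-monotone ψ ρ ρX≡P q)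
    [≔]-monotone (or φ ψ) ρ ρX≡P (p , q) =
      ¬¬-map (Sum.map ([≔]-monotone φ ρ ρX≡P p) ([≔]-monotone ψ ρ ρX≡P q))
    [≔]-monotone (ex ys φ) ρ ρX≡P p h = h
    [≔]-monotone (all ys φ) ρ ρX≡P p h = h
    [≔]-monotone (ex2 Y φ) ρ ρX≡P p h with Y ≟S X
    ... | yes _ = h
    ... | no Y≢X = ¬¬-map (λ (Q , gQ , hQ) → Q , gQ ,
        [≔]-monotone φ (update 𝔄 ρ Y Q) (update-keeps ρX≡P Q Y≢X) (unbound Y≢X p) hQ) h
    [≔]-monotone (all2 Y φ) ρ ρX≡P p h with Y ≟S X
    ... | yes _ = h
    ... | no Y≢X = λ Q gQ →
        [≔]-monotone φ (update 𝔄 ρ Y Q) (update-keeps ρX≡P Q Y≢X) (unbound Y≢X p) (h Q gQ)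
    [≔]-antitone (atom a) ρ ρX≡P n h = h
    [≔]-antitone (sv Y xs) ρ ρX≡P n h with Y ≟S X
    ... | no _ = h
    ... | yes refl = contradiction refl n
    [≔]-antitone true ρ ρX≡P n h = h
    [≔]-antitone (neg φ) ρ ρX≡P n h = h ∘ [≔]-monotone φ ρ ρX≡P n
    [≔]-antitone (and φ ψ) ρ ρX≡P (n , m) =
      Product.map ([≔]-antitone φ ρ ρX≡P n) ([≔]-antitone ψ ρ ρX≡P m)
    [≔]-antitone (or φ ψ) ρ ρX≡P (n , m) =
      ¬¬-map (Sum.map ([≔]-antitone φ ρ ρX≡P n) ([≔]-antitone ψ ρ ρX≡P m))
    [≔]-antitone (ex ys φ) ρ ρX≡P n h = h
    [≔]-antitone (all ys φ) ρ ρX≡P n h = h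
    [≔]-antitone (ex2 Y φ) ρ ρX≡P n h with Y ≟S X
    ... | yes _ = h
    ... | no Y≢X = ¬¬-map (λ (Q , gQ , hQ) → Q , gQ ,
        [≔]-antitone φ (update 𝔄 ρ Y Q) (update-keeps ρX≡P Q Y≢X) (unbound Y≢X n) hQ) h
    [≔]-antitone (all2 Y φ) ρ ρX≡P n h with Y ≟S X
    ... | yes _ = h
    ... | no Y≢X = λ Q gQ →
        [≔]-antitone φ (update 𝔄 ρ Y Q) (update-keeps ρX≡P Q Y≢X) (unbound Y≢X n) (h Q gQ)

  shannon-expansion : ∀ v φ → Pos X φ → φ ≈ₗ or (and (sv X v) (φ [ v ≔ true ])) (φ [ v ≔ false ])
  shannon-expansion v φ p = mk≈ₗ expansion
    where
    expansion : φ ≡ₗ or (and (sv X v) (φ [ v ≔ true ])) (φ [ v ≔ false ])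
    expansion 𝔄 σ ρ = to , from
      where
      ⟦_⟧′ : Formula τ → Set₁
      ⟦ ψ ⟧′ = ⟦ 𝔄 ⟧ ψ σ ρ

      mono : ∀ {b c} → (∀ ρ′ → ρ′ X ≡ ρ X → ⟦ 𝔄 ⟧ b σ ρ′ → ⟦ 𝔄 ⟧ c σ ρ′) →
             ⟦ φ [ v ≔ b ] ⟧′ → ⟦ φ [ v ≔ c ] ⟧′
      mono b⇒c = [≔]-monotone v (ρ X) b⇒c φ ρ refl p

      self : ⟦ φ ⟧′ → ⟦ φ [ v ≔ sv X v ] ⟧′
      self = subst ⟦_⟧′ (sym ([≔]-self v φ))

      self⁻¹ : ⟦ φ [ v ≔ sv X v ] ⟧′ → ⟦ φ ⟧′
      self⁻¹ = subst ⟦_⟧′ ([≔]-self v φ)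

      to-true : ⟦ φ ⟧′ → ⟦ φ [ v ≔ true ] ⟧′
      to-true = mono (λ _ _ _ → lift tt) ∘ self

      to-false : ¬ ⟦ sv X v ⟧′ → ⟦ φ ⟧′ → ⟦ φ [ v ≔ false ] ⟧′
      to-false ¬x = mono (λ ρ′ ρ′X≡ρX x _ → ¬x (⟦sv⟧-cong 𝔄 σ ρ′ ρ X v ρ′X≡ρX x)) ∘ self

      from-true : ⟦ sv X v ⟧′ → ⟦ φ [ v ≔ true ] ⟧′ → ⟦ φ ⟧′
      from-true x = self⁻¹ ∘ mono (λ ρ′ ρ′X≡ρX _ → ⟦sv⟧-cong 𝔄 σ ρ ρ′ X v (sym ρ′X≡ρX) x)

      from-false : ⟦ φ [ v ≔ false ] ⟧′ → ⟦ φ ⟧′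
      from-false = self⁻¹ ∘ mono (λ _ _ → contradiction (lift tt))

      -- the case distinction on X v is made inside the double negation
      to : ⟦ φ ⟧′ → ⟦ or (and (sv X v) (φ [ v ≔ true ])) (φ [ v ≔ false ]) ⟧′
      to h k = k (inj₂ (to-false (λ x → k (inj₁ (x , to-true h))) h))

      from : ⟦ or (and (sv X v) (φ [ v ≔ true ])) (φ [ v ≔ false ]) ⟧′ → ⟦ φ ⟧′
      from = ⟦⟧-stable 𝔄 φ σ ρ ∘ ¬¬-map [ uncurry from-true , from-false ]′

  topLevelArgs-[≔]-⊆ : ∀ v {b} φ {L} → topLevelArgs b ⊆ L → topLevelArgs φ ⊆ v ∷ L →
                       topLevelArgs (φ [ v ≔ b ]) ⊆ L
  topLevelArgs-[≔]-⊆ v {b} φ b⊆L φ⊆v∷L =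
    [ (λ (w∈φ , w≢v) → Any.tail w≢v (φ⊆v∷L w∈φ)) , b⊆L ]′ ∘ [≔]-topLevelArgs v b φ

  expand : List (Vec ℕ (ar X)) → Formula τ → List (Formula τ × Formula τ)
  expand []      φ = (true , φ) ∷ []
  expand (v ∷ L) φ = map (map₁ (and (sv X v))) (expand L (φ [ v ≔ true ])) ++ expand L (φ [ v ≔ false ])

  expand-sound : ∀ L φ → Pos X φ → φ ≈ₗ ⋁ (expand L φ)
  expand-sound [] φ p = begin
    φ                       ≈⟨ and-identityˡ φ ⟨
    and true φ              ≈⟨ or-identityʳ (and true φ) ⟨
    or (and true φ) false   ∎
    where open SetoidReasoning ≈ₗ-setoid
  expand-sound (v ∷ L) φ p = begin
    φ
      ≈⟨ shannon-expansion v φ p ⟩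
    or (and (sv X v) (φ [ v ≔ true ])) (φ [ v ≔ false ])
      ≈⟨ or-cong (and-cong ≈ₗ-refl (expand-sound L _ ([≔]-pos v true φ tt p)))
                 (expand-sound L _ ([≔]-pos v false φ tt p)) ⟩
    or (and (sv X v) (⋁ (expand L (φ [ v ≔ true ])))) (⋁ (expand L (φ [ v ≔ false ])))
      ≈⟨ ⋁-++-map-and (sv X v) _ _ ⟨
    ⋁ (expand (v ∷ L) φ)
      ∎
    where open SetoidReasoning ≈ₗ-setoid

  module _ (Rs : List SVar) (xs : List ℕ) where

    Admissible : Formula τ → Set
    Admissible φ = IsGSOg φ × Pos X φ × SOVarsIn φ (X ∷ Rs) × FOVarsIn φ xs

    IsQFPart : Formula τ → Set
    IsQFPart α = IsGSOg α × QuantifierFree α × Pos X α × SOVarsIn α (X ∷ []) × FOVarsIn α xs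

    IsQuantPart : Formula τ → Set
    IsQuantPart β = IsGSOg β × Pos X β × OnlyUnderFOQuant X β × SOVarsIn β (X ∷ Rs) × FOVarsIn β xs

    admissible-[≔] : ∀ v {b} φ → Admissible b → Admissible φ → Admissible (φ [ v ≔ b ])
    admissible-[≔] v {b} φ (gb , pb , sob , fob) (g , p , so , fo) =
        [≔]-isGSOg v b φ gb g
      , [≔]-pos v b φ pb p
      , (λ Z → [ so Z , sob Z ]′ ∘ [≔]-SOFree v b φ)
      , (λ z → [ fo z , fob z ]′ ∘ [≔]-FOFree v b φ)

    isQFPart-and-sv : ∀ {v} α → toList v ⊆ xs → IsQFPart α → IsQFPart (and (sv X v) α)
    isQFPart-and-sv α v⊆xs (g , q , p , so , fo) =
      (tt , g) , (tt , q) , (tt , p) , (λ Z → [ here , so Z ]′) , (λ z → [ v⊆xs , fo z ]′)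

    expand-wellFormed : ∀ L φ → Admissible φ → topLevelArgs φ ⊆ L → All (λ v → toList v ⊆ xs) L →
                        All (λ (α , β) → IsQFPart α × IsQuantPart β) (expand L φ)
    expand-wellFormed [] φ (g , p , so , fo) top⊆[] [] =
        ((tt , tt , tt , (λ _ ()) , (λ _ ()))
      , (g , p , topLevelArgs⊆[]⇒onlyUnderFOQuant φ top⊆[] , so , fo))
      ∷ []
    expand-wellFormed (v ∷ L) φ adm top⊆ (v⊆xs ∷ L⊆xs) =
      All.++⁺ (All.map⁺ (All.map (λ {(α , _)} → map₁ (isQFPart-and-sv α v⊆xs))
                                 (recurse true (tt , tt , (λ _ ()) , (λ _ ())) (λ ()))))
              (recurse false (tt , tt , (λ _ ()) , (λ _ ())) (λ ()))
      where
      recurse : ∀ b → Admissible b → topLevelArgs b ⊆ L →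
                All (λ (α , β) → IsQFPart α × IsQuantPart β) (expand L (φ [ v ≔ b ]))
      recurse b adm-b b⊆L =
        expand-wellFormed L _ (admissible-[≔] v φ adm-b adm) (topLevelArgs-[≔]-⊆ v φ b⊆L top⊆) L⊆xs

  isGF-[≔] : ∀ v {b} φ → IsGF b → IsGF φ → IsGF (φ [ v ≔ b ])
  isGF-[≔] v {b} φ (gb , nb) (g , n) = [≔]-isGSOg v b φ gb g , [≔]-noSOQuant v b φ nb n

  isGF-and-sv : ∀ v (α : Formula τ) → IsGF α → IsGF (and (sv X v) α)
  isGF-and-sv v α (g , n) = (tt , g) , (tt , n)

  expand-isGF : ∀ L φ → IsGF φ → All (λ (α , β) → IsGF α × IsGF β) (expand L φ)
  expand-isGF []      φ gf = ((tt , tt) , gf) ∷ []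
  expand-isGF (v ∷ L) φ gf =
    All.++⁺ (All.map⁺ (All.map (λ {(α , _)} → map₁ (isGF-and-sv v α))
                                (expand-isGF L _ (isGF-[≔] v φ (tt , tt) gf))))
            (expand-isGF L _ (isGF-[≔] v φ (tt , tt) gf))

lemma10p1 : ∀ {τ : Vocabulary} (φ : Formula τ) (Rs : List SVar) (X : SVar) (xs : List ℕ) →
    IsGSOg φ → Pos X φ → SOVarsIn φ (X ∷ Rs) → FOVarsIn φ xs →
    Σ (List (Formula τ × Formula τ)) (λ ψs →
      (φ ≡ₗ bigOr (map (λ p → and (proj₁ p) (proj₂ p)) ψs))
      × All (λ p →
          (IsGSOg (proj₁ p) × QuantifierFree (proj₁ p) × Pos X (proj₁ p)
            × SOVarsIn (proj₁ p) (X ∷ []) × FOVarsIn (proj₁ p) xs)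
          × (IsGSOg (proj₂ p) × Pos X (proj₂ p) × OnlyUnderFOQuant X (proj₂ p)
            × SOVarsIn (proj₂ p) (X ∷ Rs) × FOVarsIn (proj₂ p) xs)) ψs
      × (IsGF φ → All (λ p → IsGF (proj₁ p) × IsGF (proj₂ p)) ψs))
lemma10p1 φ Rs X xs g p so fo =
    expand L φ
  , equivalent (expand-sound L φ p)
  , expand-wellFormed Rs xs L φ (g , p , so , fo) id
      (All.tabulate λ w∈L z∈w → fo _ (topLevelArgs-FOFree φ w∈L z∈w))
  , expand-isGF L φ
  where
  open Expansion X
  L = topLevelArgs φ
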